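{- For every connected (finite, simple) graph $G$ with at least one vertex there is a tree $T$ rooted at a vertex $r$ and a partition $\mathcal{P}$ of $V(G)$ into non-empty sets, together with a bijection $x\mapsto P_x$ from $V(T)$ to $\mathcal{P}$, such that: (i) each $G[P_x]$ is connected; (ii) for distinct $x,y\in V(T)$, there is an edge of $G$ between $P_x$ and $P_y$ if and only if one of $x,y$ is an ancestor of the other in $T$; (iii) for every $x\in V(T)$ there is an independent set $I$ of $G$ with $I\subseteq P_x$ and $|P_x|=2|I|-1$; (iv) for every leaf $v$ of $T$, if $r=x_1,x_2,\dots,x_k=v$ is the path in $T$ from $r$ to $v$, then $(G[P_{x_1}],G[P_{x_2}],\dots,G[P_{x_k}])$ is a dominating $K_k$-model in $G$.
   Context: A dominating $K_t$-model in a graph $G$ is a sequence $(T_1,\dots,T_t)$ of pairwise disjoint non-empty connected subgraphs of $G$ such that for all $1\le i<j\le t$, every vertex of $T_j$ has a neighbour in $T_i$. (Conditions (i)–(ii) say that $\mathcal{P}$ is a connected partition of $G$ whose quotient graph is the closure $\widehat{T}$ of $T$, i.e. the graph on $V(T)$ where two vertices are adjacent iff one is an ancestor of the other.) -}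

module Defs where

open import Data.Nat using (ℕ; zero; suc; _*_; _∸_)
open import Data.Fin using (Fin; zero; suc; fromℕ; inject₁; _<_)
open import Data.Fin.Subset using (Subset; _∈_; _⊆_; ∣_∣; Nonempty; ⊤)
open import Data.Product using (Σ; ∃; _×_; _,_)
open import Data.Sum using (_⊎_)
open import Data.Empty using (⊥)
open import Relation.Nullary using (¬_; Dec)
open import Relation.Binary.PropositionalEquality using (_≡_; _≢_)

record Graph : Set₁ where
  field
    n      : ℕ
    Adj    : Fin n → Fin n → Set
    adj?   : ∀ u v → Dec (Adj u v)
    sym    : ∀ {u v} → Adj u v → Adj v u
    irrefl : ∀ {v} → ¬ Adj v v

open Graph public

data WalkIn (G : Graph) (S : Subset (n G)) : Fin (n G) → Fin (n G) → Set where
  here : ∀ {u} → u ∈ S → WalkIn G S u u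
  step : ∀ {u w v} → u ∈ S → Adj G u w → WalkIn G S w v → WalkIn G S u v

ConnectedIn : (G : Graph) → Subset (n G) → Set
ConnectedIn G S = ∀ u v → u ∈ S → v ∈ S → WalkIn G S u v

Connected : Graph → Set
Connected G = ConnectedIn G ⊤

Disjoint : ∀ {k} → Subset k → Subset k → Set
Disjoint P Q = ∀ v → v ∈ P → v ∈ Q → ⊥

Independent : (G : Graph) → Subset (n G) → Set
Independent G I = ∀ u v → u ∈ I → v ∈ I → ¬ Adj G u v

EdgeBetween : (G : Graph) → Subset (n G) → Subset (n G) → Set
EdgeBetween G P Q = Σ (Fin (n G)) λ u → Σ (Fin (n G)) λ v → u ∈ P × v ∈ Q × Adj G u v

DominatingModel : (G : Graph) (k : ℕ) → (Fin k → Subset (n G)) → Set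
DominatingModel G k S =
    (∀ i j → i ≢ j → Disjoint (S i) (S j))
  × (∀ i → Nonempty (S i))
  × (∀ i → ConnectedIn G (S i))
  × (∀ i j → i < j → ∀ u → u ∈ S j → Σ (Fin (n G)) λ w → w ∈ S i × Adj G u w)

iterate : ∀ {A : Set} → (A → A) → ℕ → A → A
iterate f zero x = x
iterate f (suc k) x = f (iterate f k x)

-- A rooted tree on vertex set Fin m, given by its parent map:
-- the edges are {x , parent x} for x ≠ root, and every vertex reaches the root.
record RootedTree : Set where
  field
    m           : ℕ
    root        : Fin m
    parent      : Fin m → Fin m
    parent-root : parent root ≡ root
    reaches     : ∀ x → ∃ λ k → iterate parent k x ≡ root

open RootedTree public

Ancestor : (T : RootedTree) → Fin (m T) → Fin (m T) → Set
Ancestor T x y = ∃ λ k → iterate (parent T) k y ≡ x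

Child : (T : RootedTree) → Fin (m T) → Fin (m T) → Set
Child T y x = y ≢ root T × parent T y ≡ x

Leaf : (T : RootedTree) → Fin (m T) → Set
Leaf T v = ∀ y → ¬ Child T y v

-- xs : Fin (suc j) → V(T) is the path x_1 = root, ..., x_{j+1} = v in T
RootPath : (T : RootedTree) (v : Fin (m T)) (j : ℕ) → (Fin (suc j) → Fin (m T)) → Set
RootPath T v j xs =
    xs zero ≡ root T
  × xs (fromℕ j) ≡ v
  × (∀ (i : Fin j) → Child T (xs (suc i)) (xs (inject₁ i)))

Good : (G : Graph) (T : RootedTree) → (Fin (m T) → Subset (n G)) → Set
Good G T P =
    -- P is a partition of V(G) into non-empty sets indexed bijectively by V(T)
    (∀ x → Nonempty (P x))
  × (∀ x y → x ≢ y → Disjoint (P x) (P y))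
  × (∀ v → Σ (Fin (m T)) λ x → v ∈ P x)
  × (∀ x → ConnectedIn G (P x))
  × (∀ x y → x ≢ y →
       (EdgeBetween G (P x) (P y) → Ancestor T x y ⊎ Ancestor T y x)
     × (Ancestor T x y ⊎ Ancestor T y x → EdgeBetween G (P x) (P y)))
  × (∀ x → Σ (Subset (n G)) λ I → Independent G I × I ⊆ P x × ∣ P x ∣ ≡ 2 * ∣ I ∣ ∸ 1)
  × (∀ v → Leaf T v → ∀ j (xs : Fin (suc j) → Fin (m T)) → RootPath T v j xs →
       DominatingModel G (suc j) (λ i → P (xs i)))

-- The parts are built one at a time. Invariant: every vertex not yet assigned to a part is
-- adjacent to exactly the parts on the tree path from the root to some part y, and this set of
-- parts is constant along edges between unassigned vertices. A new part Q is grown greedily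
-- inside the unassigned set U from a vertex u: starting from {u}, repeatedly add an edge w w′ of
-- G[U − Q] with w adjacent to Q and w′ not; collecting the vertices w′ (and u) in I keeps I
-- independent and |Q| = 2|I| − 1. Q becomes a child of the part y of u. As Q lies in the
-- component of u in G[U], every vertex of Q sees exactly the ancestors of y, which gives the
-- domination; and once no such edge is left, adjacency to Q is constant along the remaining
-- edges of G[U − Q], so the invariant survives. For the first part, connectivity of G makes every
-- other vertex adjacent to it.

{-# OPTIONS --safe #-}
module Submission where

open import Data.Nat using (_<_)
open import Data.Fin.Subset using (Subset)
open import Data.Fin using (Fin)
open import Data.Product using (Σ)

open import Level using (0ℓ)
open import Function using (_∘_; _⇔_; mk⇔; Equivalence)
open import Function.Properties.Equivalence using () renaming (sym to ⇔-sym; trans to ⇔-trans)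
open import Data.Empty using (⊥-elim)
open import Data.Product using (∃; _×_; _,_; proj₁; proj₂)
open import Data.Sum as Sum using (_⊎_; inj₁; inj₂)
open import Relation.Nullary using (¬_; Dec; yes; no; ¬?; _×-dec_)
open import Relation.Binary.Definitions using (tri<; tri≈; tri>)
open import Relation.Binary.PropositionalEquality
  using (_≡_; _≢_; refl; sym; trans; cong; subst; module ≡-Reasoning)
import Relation.Binary.Construct.On as On
open import Induction.WellFounded using (module All)
open import Data.Nat using (ℕ; zero; suc; _+_; _*_; _∸_; _≤_; z≤n; s≤s; z<s; _≟_)
open import Data.Nat.Properties
open import Data.Nat.Induction using (<-wellFounded; <-rec)
open import Data.Fin as Fin using (zero; suc; toℕ; fromℕ<; inject₁)
open import Data.Fin.Properties as Finₚ using (toℕ-injective; toℕ-fromℕ<; toℕ<n; toℕ-inject₁; any?)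
open import Data.Vec.Base using (_∷_; here; there)
open import Data.Fin.Subset
  using (inside; outside; _∈_; _∉_; _⊆_; _⊂_; ⁅_⁆; _∪_; _─_; ∁; ∣_∣; Nonempty; Empty; ⊤)
  renaming (⊥ to ∅)
open import Data.Fin.Subset.Properties
  using ( _∈?_; nonempty?; ∈⊤; ∉⊥; x∈⁅x⁆; x∈⁅y⁆⇒x≡y; ∣⁅x⁆∣≡1; ∪-identityʳ
        ; x∈p∪q⁻; p⊆p∪q; q⊆p∪q; x∈p∩q⁺; x∈p∧x∉q⇒x∈p─q; p─q⊆p
        ; p∩q≢∅⇒∣p─q∣<∣p∣; p⊂q⇒∣p∣<∣q∣; p⊂q⇒∁p⊃∁q )

open import Defs renaming (sym to adj-sym)

open Equivalence using (to; from)

saturate : ∀ {S : Set} {Done : S → Set} (μ : S → ℕ) →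
           (∀ s → Done s ⊎ Σ S λ s′ → μ s′ < μ s) → S → Σ S Done
saturate {S} {Done} μ advance =
  All.wfRec (On.wellFounded μ <-wellFounded) 0ℓ (λ _ → Σ S Done) go
  where
  go : ∀ s → (∀ {s′} → μ s′ < μ s → Σ S Done) → Σ S Done
  go s rec with advance s
  ... | inj₁ done       = s , done
  ... | inj₂ (s′ , μ<μ) = rec μ<μ

x∈p─q⇒x∉q : ∀ {k} (p q : Subset k) {x} → x ∈ p ─ q → x ∉ q
x∈p─q⇒x∉q (_ ∷ p) (inside  ∷ q) {zero}  ()
x∈p─q⇒x∉q (_ ∷ p) (outside ∷ q) {zero}  _         ()
x∈p─q⇒x∉q (_ ∷ p) (_       ∷ q) {suc x} (there h) (there h′) = x∈p─q⇒x∉q p q h h′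

x∈p∪⁅y⁆⁻ : ∀ {k} (p : Subset k) {x y} → x ∈ p ∪ ⁅ y ⁆ → x ∈ p ⊎ x ≡ y
x∈p∪⁅y⁆⁻ p {y = y} = Sum.map₂ (x∈⁅y⁆⇒x≡y y) ∘ x∈p∪q⁻ p ⁅ y ⁆

∣p∪⁅x⁆∣≡1+∣p∣ : ∀ {k} (p : Subset k) x → x ∉ p → ∣ p ∪ ⁅ x ⁆ ∣ ≡ suc ∣ p ∣
∣p∪⁅x⁆∣≡1+∣p∣ (inside  ∷ p) zero    x∉p = ⊥-elim (x∉p here)
∣p∪⁅x⁆∣≡1+∣p∣ (outside ∷ p) zero    _   = cong (suc ∘ ∣_∣) (∪-identityʳ p)
∣p∪⁅x⁆∣≡1+∣p∣ (inside  ∷ p) (suc x) x∉p = cong suc (∣p∪⁅x⁆∣≡1+∣p∣ p x (x∉p ∘ there))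
∣p∪⁅x⁆∣≡1+∣p∣ (outside ∷ p) (suc x) x∉p = ∣p∪⁅x⁆∣≡1+∣p∣ p x (x∉p ∘ there)

_[_≔_] : ∀ {A : Set} → (ℕ → A) → ℕ → A → ℕ → A
(f [ k ≔ a ]) i with i ≟ k
... | yes _ = a
... | no  _ = f i

[≔]-same : ∀ {A : Set} (f : ℕ → A) k {a} → (f [ k ≔ a ]) k ≡ a
[≔]-same f k with k ≟ k
... | yes _   = refl
... | no  k≢k = ⊥-elim (k≢k refl)

[≔]-other : ∀ {A : Set} (f : ℕ → A) {k a i} → i ≢ k → (f [ k ≔ a ]) i ≡ f i
[≔]-other f {k} {i = i} i≢k with i ≟ k
... | yes i≡k = ⊥-elim (i≢k i≡k)
... | no  _   = refl

-- Ancestor T is definitionally Ancestor′ (parent T).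
Ancestor′ : ∀ {A : Set} → (A → A) → A → A → Set
Ancestor′ f x y = ∃ λ d → iterate f d y ≡ x

module _ {A : Set} (f : A → A) where

  iterate-+ : ∀ d e x → iterate f (d + e) x ≡ iterate f d (iterate f e x)
  iterate-+ zero    e x = refl
  iterate-+ (suc d) e x = cong f (iterate-+ d e x)

  iterate-suc′ : ∀ d x → iterate f (suc d) x ≡ iterate f d (f x)
  iterate-suc′ zero    x = refl
  iterate-suc′ (suc d) x = cong f (iterate-suc′ d x)

  ancestor′-refl : ∀ {x} → Ancestor′ f x x
  ancestor′-refl = 0 , refl

  ancestor′-parent : ∀ {x} → Ancestor′ f (f x) x
  ancestor′-parent = 1 , refl

  ancestor′-trans : ∀ {x y z} → Ancestor′ f x y → Ancestor′ f y z → Ancestor′ f x z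
  ancestor′-trans {z = z} (d , fᵈy≡x) (e , fᵉz≡y) =
    d + e , trans (iterate-+ d e z) (trans (cong (iterate f d) fᵉz≡y) fᵈy≡x)

  ancestor′-unfold : ∀ {x y} → Ancestor′ f x y ⇔ (x ≡ y ⊎ Ancestor′ f x (f y))
  ancestor′-unfold {x} {y} = mk⇔ split join
    where
    split : Ancestor′ f x y → x ≡ y ⊎ Ancestor′ f x (f y)
    split (zero  , y≡x) = inj₁ (sym y≡x)
    split (suc d , e)   = inj₂ (d , trans (sym (iterate-suc′ d y)) e)
    join : x ≡ y ⊎ Ancestor′ f x (f y) → Ancestor′ f x y
    join (inj₁ refl) = ancestor′-refl
    join (inj₂ anc)  = ancestor′-trans anc ancestor′-parent

module _ {f : ℕ → ℕ} (f≤ : ∀ z → f z ≤ z) where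

  iterate-≤ : ∀ d x → iterate f d x ≤ x
  iterate-≤ zero    x = ≤-refl
  iterate-≤ (suc d) x = ≤-trans (f≤ _) (iterate-≤ d x)

  ancestor′-≤ : ∀ {i j} → Ancestor′ f i j → i ≤ j
  ancestor′-≤ (d , e) = subst (_≤ _) e (iterate-≤ d _)

  module _ {g : ℕ → ℕ} {k} (g≡f : ∀ {z} → z < k → g z ≡ f z) where

    iterate-agree : ∀ d {x} → x < k → iterate g d x ≡ iterate f d x
    iterate-agree zero    x<k = refl
    iterate-agree (suc d) x<k rewrite iterate-agree d x<k =
      g≡f (≤-<-trans (iterate-≤ d _) x<k)

    ancestor′-agree : ∀ {i j} → j < k → Ancestor′ g i j ⇔ Ancestor′ f i j
    ancestor′-agree j<k = mk⇔ (λ (d , e) → d , trans (sym (iterate-agree d j<k)) e)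
                              (λ (d , e) → d , trans (iterate-agree d j<k) e)

record Decreasing (f : ℕ → ℕ) : Set where
  field
    fixes-0 : f 0 ≡ 0
    below   : ∀ {z} → 0 < z → f z < z

  ≤-self : ∀ z → f z ≤ z
  ≤-self zero    = ≤-reflexive fixes-0
  ≤-self (suc z) = <⇒≤ (below z<s)

  reaches-0 : ∀ z → Ancestor′ f 0 z
  reaches-0 = <-rec _ λ where
    zero    _   → ancestor′-refl f
    (suc z) rec → ancestor′-trans f (rec (below z<s)) (ancestor′-parent f)

module RootPaths (T : RootedTree) (rank : Fin (m T) → ℕ)
                 (rank-parent : ∀ {x} → x ≢ root T → rank (parent T x) < rank x) where

  rank-parent-≤ : ∀ x → rank (parent T x) ≤ rank x
  rank-parent-≤ x with x Finₚ.≟ root T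
  ... | yes refl = ≤-reflexive (cong rank (parent-root T))
  ... | no  x≢r  = <⇒≤ (rank-parent x≢r)

  rank-ancestor : ∀ {x y} → Ancestor T x y → rank x ≤ rank y
  rank-ancestor (zero  , refl) = ≤-refl
  rank-ancestor (suc d , refl) = ≤-trans (rank-parent-≤ _) (rank-ancestor (d , refl))

  module _ {j} {xs : Fin (suc j) → Fin (m T)}
           (chain : ∀ (i : Fin j) → Child T (xs (suc i)) (xs (inject₁ i))) where

    chain-iterate : ∀ d (a b : Fin (suc j)) → toℕ a + d ≡ toℕ b →
                    iterate (parent T) d (xs b) ≡ xs a
    chain-iterate zero    a b       a+0≡b =
      cong xs (toℕ-injective (trans (sym a+0≡b) (+-identityʳ _)))
    chain-iterate (suc d) a zero    a+d≡0 = ⊥-elim (m+1+n≢0 (toℕ a) a+d≡0)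
    chain-iterate (suc d) a (suc b) a+d≡b = begin
      iterate (parent T) (suc d) (xs (suc b))      ≡⟨ iterate-suc′ (parent T) d (xs (suc b)) ⟩
      iterate (parent T) d (parent T (xs (suc b))) ≡⟨ cong (iterate (parent T) d) (proj₂ (chain b)) ⟩
      iterate (parent T) d (xs (inject₁ b))        ≡⟨ chain-iterate d a (inject₁ b) a+d≡b′ ⟩
      xs a                                         ∎
      where
      open ≡-Reasoning
      a+d≡b′ : toℕ a + d ≡ toℕ (inject₁ b)
      a+d≡b′ = trans (suc-injective (trans (sym (+-suc (toℕ a) d)) a+d≡b)) (sym (toℕ-inject₁ b))

    chain-ancestor : ∀ {a b} → a Fin.≤ b → Ancestor T (xs a) (xs b)
    chain-ancestor {a} {b} a≤b = toℕ b ∸ toℕ a , chain-iterate _ a b (m+[n∸m]≡n a≤b)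

    chain-rank-< : ∀ {a b} → a Fin.< b → rank (xs a) < rank (xs b)
    chain-rank-< {a} {suc b} a<b = begin-strict
      rank (xs a)                   ≤⟨ rank-ancestor (chain-ancestor (Finₚ.<⇒≤pred a<b)) ⟩
      rank (xs (inject₁ b))         ≡⟨ cong rank (sym (proj₂ (chain b))) ⟩
      rank (parent T (xs (suc b)))  <⟨ rank-parent (proj₁ (chain b)) ⟩
      rank (xs (suc b))             ∎
      where open ≤-Reasoning

    chain-injective : ∀ {a b} → a ≢ b → xs a ≢ xs b
    chain-injective {a} {b} a≢b xa≡xb with Finₚ.<-cmp a b
    ... | tri< a<b _ _ = <⇒≢ (chain-rank-< a<b) (cong rank xa≡xb)
    ... | tri≈ _ a≡b _ = a≢b a≡b
    ... | tri> _ _ b<a = <⇒≢ (chain-rank-< b<a) (cong rank (sym xa≡xb))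

module ℕTree {k : ℕ} (0<k : 0 < k) {par : ℕ → ℕ} (par-decreasing : Decreasing par) where

  open Decreasing par-decreasing

  parentᶠ : Fin k → Fin k
  parentᶠ x = fromℕ< (≤-<-trans (≤-self (toℕ x)) (toℕ<n x))

  rootᶠ : Fin k
  rootᶠ = fromℕ< 0<k

  toℕ-rootᶠ : toℕ rootᶠ ≡ 0
  toℕ-rootᶠ = toℕ-fromℕ< 0<k

  toℕ-parentᶠ : ∀ x → toℕ (parentᶠ x) ≡ par (toℕ x)
  toℕ-parentᶠ x = toℕ-fromℕ< _

  toℕ-iterate : ∀ d x → toℕ (iterate parentᶠ d x) ≡ iterate par d (toℕ x)
  toℕ-iterate zero    x = refl
  toℕ-iterate (suc d) x = trans (toℕ-parentᶠ _) (cong par (toℕ-iterate d x))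

  ancestor⇔ : ∀ {x y} → Ancestor′ parentᶠ x y ⇔ Ancestor′ par (toℕ x) (toℕ y)
  ancestor⇔ {x} {y} = mk⇔ (λ (d , e) → d , trans (sym (toℕ-iterate d y)) (cong toℕ e))
                          (λ (d , e) → d , toℕ-injective (trans (toℕ-iterate d y) e))

  tree : RootedTree
  tree = record
    { m           = k
    ; root        = rootᶠ
    ; parent      = parentᶠ
    ; parent-root = toℕ-injective (begin
        toℕ (parentᶠ rootᶠ) ≡⟨ toℕ-parentᶠ rootᶠ ⟩
        par (toℕ rootᶠ)     ≡⟨ cong par toℕ-rootᶠ ⟩
        par 0               ≡⟨ fixes-0 ⟩
        0                   ≡⟨ toℕ-rootᶠ ⟨
        toℕ rootᶠ           ∎)
    ; reaches     = λ x → from ancestor⇔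
        (subst (λ r → Ancestor′ par r (toℕ x)) (sym toℕ-rootᶠ) (reaches-0 (toℕ x)))
    }
    where open ≡-Reasoning

  parentᶠ-< : ∀ {x} → x ≢ rootᶠ → toℕ (parentᶠ x) < toℕ x
  parentᶠ-< {x} x≢r = subst (_< toℕ x) (sym (toℕ-parentᶠ x))
    (below (n≢0⇒n>0 λ x≡0 → x≢r (toℕ-injective (trans x≡0 (sym toℕ-rootᶠ)))))

  open RootPaths tree toℕ parentᶠ-< public

module Walks (G : Graph) where

  walk-start : ∀ {S u v} → WalkIn G S u v → u ∈ S
  walk-start (here u∈S)     = u∈S
  walk-start (step u∈S _ _) = u∈S

  walk-++ : ∀ {S u v w} → WalkIn G S u v → WalkIn G S v w → WalkIn G S u w
  walk-++ (here _)       q = q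
  walk-++ (step u∈S a p) q = step u∈S a (walk-++ p q)

  walk-reverse : ∀ {S u v} → WalkIn G S u v → WalkIn G S v u
  walk-reverse (here u∈S)     = here u∈S
  walk-reverse (step u∈S a p) =
    walk-++ (walk-reverse p) (step (walk-start p) (adj-sym G a) (here u∈S))

  walk-mono : ∀ {S S′ u v} → S ⊆ S′ → WalkIn G S u v → WalkIn G S′ u v
  walk-mono S⊆S′ (here u∈S)     = here (S⊆S′ u∈S)
  walk-mono S⊆S′ (step u∈S a p) = step (S⊆S′ u∈S) a (walk-mono S⊆S′ p)

  walk-transport : ∀ {S u v} (Φ : Fin (n G) → Set) →
                   (∀ {a b} → a ∈ S → b ∈ S → Adj G a b → Φ a → Φ b) →
                   WalkIn G S u v → Φ u → Φ v
  walk-transport Φ along (here _)       Φu = Φu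
  walk-transport Φ along (step u∈S a p) Φu =
    walk-transport Φ along p (along u∈S (walk-start p) a Φu)

  connectedIn-hub : ∀ {S h} → (∀ {a} → a ∈ S → WalkIn G S a h) → ConnectedIn G S
  connectedIn-hub to-h a b a∈S b∈S = walk-++ (to-h a∈S) (walk-reverse (to-h b∈S))

AdjacentTo : (G : Graph) → Fin (n G) → Subset (n G) → Set
AdjacentTo G u S = Σ (Fin (n G)) λ w → w ∈ S × Adj G u w

-- |S| = 2|I| - 1, written without truncated subtraction.
Balanced : (G : Graph) → Subset (n G) → Set
Balanced G S = Σ (Subset (n G)) λ I → Independent G I × I ⊆ S × suc ∣ S ∣ ≡ 2 * ∣ I ∣

FrontierEdge : (G : Graph) → Subset (n G) → Subset (n G) → Set
FrontierEdge G U Q = Σ (Fin (n G)) λ w → Σ (Fin (n G)) λ w′ →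
  w ∈ U ─ Q × w′ ∈ U ─ Q × Adj G w w′ × AdjacentTo G w Q × ¬ AdjacentTo G w′ Q

module Growth (G : Graph) where

  open Walks G

  adjacentTo? : ∀ u S → Dec (AdjacentTo G u S)
  adjacentTo? u S = any? λ w → w ∈? S ×-dec adj? G u w

  frontierEdge? : ∀ U Q → Dec (FrontierEdge G U Q)
  frontierEdge? U Q = any? λ w → any? λ w′ →
    w ∈? U ─ Q ×-dec w′ ∈? U ─ Q ×-dec adj? G w w′
      ×-dec adjacentTo? w Q ×-dec ¬? (adjacentTo? w′ Q)

  no-frontier⇒adjacent : ∀ {U Q w w′} → ¬ FrontierEdge G U Q → w ∈ U ─ Q → w′ ∈ U ─ Q →
                         Adj G w w′ → AdjacentTo G w Q → AdjacentTo G w′ Q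
  no-frontier⇒adjacent {Q = Q} {w′ = w′} no-frontier w∈ w′∈ ww′ wQ with adjacentTo? w′ Q
  ... | yes w′Q = w′Q
  ... | no ¬w′Q = ⊥-elim (no-frontier (_ , _ , w∈ , w′∈ , ww′ , wQ , ¬w′Q))

  no-frontier⇒dominating : ∀ {Q u} → Connected G → u ∈ Q → ¬ FrontierEdge G ⊤ Q →
                           ∀ {w} → w ∉ Q → AdjacentTo G w Q
  no-frontier⇒dominating {Q} {u} connected u∈Q no-frontier {w} w∉Q
    with walk-transport Φ along (connected u w ∈⊤ ∈⊤) (inj₁ u∈Q)
    where
    Φ : Fin (n G) → Set
    Φ x = x ∈ Q ⊎ AdjacentTo G x Q
    along : ∀ {a b} → a ∈ ⊤ → b ∈ ⊤ → Adj G a b → Φ a → Φ b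
    along {a} {b} _ _ ab Φa with b ∈? Q | a ∈? Q | Φa
    ... | yes b∈Q | _       | _       = inj₁ b∈Q
    ... | no  _   | yes a∈Q | _       = inj₂ (a , a∈Q , adj-sym G ab)
    ... | no  _   | no  _   | inj₁ a∈Q = inj₂ (a , a∈Q , adj-sym G ab)
    ... | no  b∉Q | no  a∉Q | inj₂ aQ  = inj₂ (no-frontier⇒adjacent no-frontier
                                            (x∈p∧x∉q⇒x∈p─q ∈⊤ a∉Q) (x∈p∧x∉q⇒x∈p─q ∈⊤ b∉Q) ab aQ)
  ... | inj₁ w∈Q = ⊥-elim (w∉Q w∈Q)
  ... | inj₂ wQ  = wQ

  independent-∪⁅⁆ : ∀ {I w} → Independent G I → (∀ {v} → v ∈ I → ¬ Adj G w v) →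
                    Independent G (I ∪ ⁅ w ⁆)
  independent-∪⁅⁆ {I} I-ind w-far a b a∈ b∈ ab with x∈p∪⁅y⁆⁻ I a∈ | x∈p∪⁅y⁆⁻ I b∈
  ... | inj₁ a∈I | inj₁ b∈I = I-ind a b a∈I b∈I ab
  ... | inj₁ a∈I | inj₂ refl = w-far a∈I (adj-sym G ab)
  ... | inj₂ refl | inj₁ b∈I = w-far b∈I ab
  ... | inj₂ refl | inj₂ refl = irrefl G ab

  balanced-extend : ∀ {Q w w′} → Balanced G Q → w ∉ Q → w′ ∉ Q ∪ ⁅ w ⁆ →
                    ¬ AdjacentTo G w′ Q → Balanced G ((Q ∪ ⁅ w ⁆) ∪ ⁅ w′ ⁆)
  balanced-extend {Q} {w} {w′} (I , I-ind , I⊆Q , size) w∉Q w′∉Q₁ ¬w′Q =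
    I ∪ ⁅ w′ ⁆ , independent-∪⁅⁆ I-ind (λ v∈I w′v → ¬w′Q (_ , I⊆Q v∈I , w′v)) , I′⊆Q′ , size′
    where
    open ≡-Reasoning
    w′∉I : w′ ∉ I
    w′∉I = w′∉Q₁ ∘ p⊆p∪q ⁅ w ⁆ ∘ I⊆Q
    I′⊆Q′ : I ∪ ⁅ w′ ⁆ ⊆ (Q ∪ ⁅ w ⁆) ∪ ⁅ w′ ⁆
    I′⊆Q′ v∈I′ with x∈p∪⁅y⁆⁻ I v∈I′
    ... | inj₁ v∈I = p⊆p∪q ⁅ w′ ⁆ (p⊆p∪q ⁅ w ⁆ (I⊆Q v∈I))
    ... | inj₂ refl = q⊆p∪q (Q ∪ ⁅ w ⁆) ⁅ w′ ⁆ (x∈⁅x⁆ w′)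
    size′ : suc ∣ (Q ∪ ⁅ w ⁆) ∪ ⁅ w′ ⁆ ∣ ≡ 2 * ∣ I ∪ ⁅ w′ ⁆ ∣
    size′ = begin
      suc ∣ (Q ∪ ⁅ w ⁆) ∪ ⁅ w′ ⁆ ∣ ≡⟨ cong suc (∣p∪⁅x⁆∣≡1+∣p∣ (Q ∪ ⁅ w ⁆) w′ w′∉Q₁) ⟩
      2 + ∣ Q ∪ ⁅ w ⁆ ∣           ≡⟨ cong (2 +_) (∣p∪⁅x⁆∣≡1+∣p∣ Q w w∉Q) ⟩
      2 + suc ∣ Q ∣               ≡⟨ cong (2 +_) size ⟩
      2 + 2 * ∣ I ∣               ≡⟨ sym (*-suc 2 ∣ I ∣) ⟩
      2 * suc ∣ I ∣               ≡⟨ cong (2 *_) (sym (∣p∪⁅x⁆∣≡1+∣p∣ I w′ w′∉I)) ⟩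
      2 * ∣ I ∪ ⁅ w′ ⁆ ∣          ∎

  record Piece (U : Subset (n G)) (u : Fin (n G)) : Set where
    field
      Q        : Subset (n G)
      Q⊆U      : Q ⊆ U
      u∈Q      : u ∈ Q
      balanced : Balanced G Q
      to-u     : ∀ {a} → a ∈ Q → WalkIn G Q a u

    connected : ConnectedIn G Q
    connected = connectedIn-hub to-u

  singleton-piece : ∀ {U u} → u ∈ U → Piece U u
  singleton-piece {U} {u} u∈U = record
    { Q        = ⁅ u ⁆
    ; Q⊆U      = λ a∈ → subst (_∈ U) (sym (x∈⁅y⁆⇒x≡y u a∈)) u∈U
    ; u∈Q      = x∈⁅x⁆ u
    ; balanced = ⁅ u ⁆ , independent , (λ a∈ → a∈) , size
    ; to-u     = λ a∈ → subst (λ a → WalkIn G ⁅ u ⁆ a u) (sym (x∈⁅y⁆⇒x≡y u a∈)) (here (x∈⁅x⁆ u))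
    }
    where
    size : suc ∣ ⁅ u ⁆ ∣ ≡ 2 * ∣ ⁅ u ⁆ ∣
    size = trans (cong suc (∣⁅x⁆∣≡1 u)) (cong (2 *_) (sym (∣⁅x⁆∣≡1 u)))
    independent : Independent G ⁅ u ⁆
    independent a b a∈ b∈ ab with x∈⁅y⁆⇒x≡y u a∈ | x∈⁅y⁆⇒x≡y u b∈
    ... | refl | refl = irrefl G ab

  extend-piece : ∀ {U u} (p : Piece U u) → FrontierEdge G U (Piece.Q p) →
                 Σ (Piece U u) λ p′ → Piece.Q p ⊂ Piece.Q p′
  extend-piece {U} {u} p (w , w′ , w∈ , w′∈ , ww′ , (q , q∈Q , wq) , ¬w′Q) =
    p′ , Q⊆Q′ , w , w∈Q′ , w∉Q
    where
    open Piece p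
    Q′ = (Q ∪ ⁅ w ⁆) ∪ ⁅ w′ ⁆
    w∉Q : w ∉ Q
    w∉Q = x∈p─q⇒x∉q U Q w∈
    w′∉Q₁ : w′ ∉ Q ∪ ⁅ w ⁆
    w′∉Q₁ w′∈Q₁ with x∈p∪⁅y⁆⁻ Q w′∈Q₁
    ... | inj₁ w′∈Q = x∈p─q⇒x∉q U Q w′∈ w′∈Q
    ... | inj₂ refl = irrefl G ww′
    Q⊆Q′ : Q ⊆ Q′
    Q⊆Q′ = p⊆p∪q ⁅ w′ ⁆ ∘ p⊆p∪q ⁅ w ⁆
    w∈Q′ : w ∈ Q′
    w∈Q′ = p⊆p∪q ⁅ w′ ⁆ (q⊆p∪q Q ⁅ w ⁆ (x∈⁅x⁆ w))
    w′∈Q′ : w′ ∈ Q′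
    w′∈Q′ = q⊆p∪q (Q ∪ ⁅ w ⁆) ⁅ w′ ⁆ (x∈⁅x⁆ w′)
    Q′-cases : ∀ {a} → a ∈ Q′ → a ∈ Q ⊎ a ≡ w ⊎ a ≡ w′
    Q′-cases a∈ with x∈p∪⁅y⁆⁻ (Q ∪ ⁅ w ⁆) a∈
    ... | inj₂ a≡w′ = inj₂ (inj₂ a≡w′)
    ... | inj₁ a∈Q₁ = Sum.map₂ inj₁ (x∈p∪⁅y⁆⁻ Q a∈Q₁)
    Q′⊆U : Q′ ⊆ U
    Q′⊆U a∈ with Q′-cases a∈
    ... | inj₁ a∈Q         = Q⊆U a∈Q
    ... | inj₂ (inj₁ refl) = p─q⊆p U Q w∈
    ... | inj₂ (inj₂ refl) = p─q⊆p U Q w′∈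
    w-to-u : WalkIn G Q′ w u
    w-to-u = step w∈Q′ wq (walk-mono Q⊆Q′ (to-u q∈Q))
    to-u′ : ∀ {a} → a ∈ Q′ → WalkIn G Q′ a u
    to-u′ a∈ with Q′-cases a∈
    ... | inj₁ a∈Q         = walk-mono Q⊆Q′ (to-u a∈Q)
    ... | inj₂ (inj₁ refl) = w-to-u
    ... | inj₂ (inj₂ refl) = step w′∈Q′ (adj-sym G ww′) w-to-u
    p′ : Piece U u
    p′ = record { Q = Q′ ; Q⊆U = Q′⊆U ; u∈Q = Q⊆Q′ u∈Q
                ; balanced = balanced-extend balanced w∉Q w′∉Q₁ ¬w′Q ; to-u = to-u′ }

  grow : ∀ {U u} → u ∈ U → Σ (Piece U u) λ p → ¬ FrontierEdge G U (Piece.Q p)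
  grow {U} {u} u∈U = saturate (λ p → ∣ ∁ (Piece.Q p) ∣) advance (singleton-piece u∈U)
    where
    advance : ∀ p → ¬ FrontierEdge G U (Piece.Q p)
                  ⊎ Σ (Piece U u) λ p′ → ∣ ∁ (Piece.Q p′) ∣ < ∣ ∁ (Piece.Q p) ∣
    advance p with frontierEdge? U (Piece.Q p)
    ... | no  no-frontier = inj₁ no-frontier
    ... | yes frontier    = let (p′ , Q⊂Q′) = extend-piece p frontier
                            in inj₂ (p′ , p⊂q⇒∣p∣<∣q∣ (p⊂q⇒∁p⊃∁q Q⊂Q′))

module Model (G : Graph) where

  open Walks G
  open Growth G

  -- Parts are indexed by ℕ, with part i = ∅ for i ≥ k, and par is the parent map of the tree
  -- on 0, …, k - 1 rooted at 0; U is the set of vertices not yet assigned to a part.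
  record PartialModel : Set where
    field
      k              : ℕ
      part           : ℕ → Subset (n G)
      par            : ℕ → ℕ
      U              : Subset (n G)
      0<k            : 0 < k
      par-decreasing : Decreasing par
      part-bounded   : ∀ {i v} → v ∈ part i → i < k
      covered        : ∀ v → v ∈ U ⊎ ∃ λ i → v ∈ part i
      U-disjoint     : ∀ {i v} → v ∈ U → v ∉ part i
      part-disjoint  : ∀ {i j v} → v ∈ part i → v ∈ part j → i ≡ j
      nonempty       : ∀ {i} → i < k → Nonempty (part i)
      connected      : ∀ i → ConnectedIn G (part i)
      balanced       : ∀ {i} → i < k → Balanced G (part i)
      edge⇒ancestor  : ∀ {i j} → i ≢ j → EdgeBetween G (part i) (part j) →
                       Ancestor′ par i j ⊎ Ancestor′ par j i
      dominated      : ∀ {i j} → i ≢ j → Ancestor′ par i j →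
                       ∀ {v} → v ∈ part j → AdjacentTo G v (part i)
      attached       : ∀ {u} → u ∈ U →
                       ∃ λ y → y < k × ∀ i → AdjacentTo G u (part i) ⇔ Ancestor′ par i y
      uniform        : ∀ {u w} → u ∈ U → w ∈ U → Adj G u w →
                       ∀ i → AdjacentTo G u (part i) → AdjacentTo G w (part i)

  initial : Fin (n G) → Connected G → PartialModel
  initial v₀ conn = record
    { k              = 1
    ; part           = part₀
    ; par            = λ _ → 0
    ; U              = ⊤ ─ Q
    ; 0<k            = z<s
    ; par-decreasing = record { fixes-0 = refl ; below = λ { {suc _} _ → z<s } }
    ; part-bounded   = λ {i} v∈ → ≤-reflexive (cong suc (in-0 i v∈))
    ; covered        = covered₀
    ; U-disjoint     = λ {i} v∈U v∈ → x∈p─q⇒x∉q ⊤ Q v∈U (in-Q i v∈)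
    ; part-disjoint  = λ {i} {j} v∈i v∈j → trans (in-0 i v∈i) (sym (in-0 j v∈j))
    ; nonempty       = λ { {zero} _ → v₀ , u∈Q ; {suc _} (s≤s ()) }
    ; connected      = connected₀
    ; balanced       = λ { {zero} _ → balanced ; {suc _} (s≤s ()) }
    ; edge⇒ancestor  = λ { {i} {j} i≢j (_ , _ , a∈ , b∈ , _) →
                           ⊥-elim (i≢j (trans (in-0 i a∈) (sym (in-0 j b∈)))) }
    ; dominated      = dominated₀
    ; attached       = λ u∈U → 0 , z<s , attached₀ u∈U
    ; uniform        = uniform₀
    }
    where
    open Σ (grow (∈⊤ {x = v₀})) renaming (proj₁ to piece; proj₂ to no-frontier)
    open Piece piece
    dominates : ∀ {w} → w ∈ ⊤ ─ Q → AdjacentTo G w Q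
    dominates w∈U = no-frontier⇒dominating conn u∈Q no-frontier (x∈p─q⇒x∉q ⊤ Q w∈U)
    part₀ : ℕ → Subset (n G)
    part₀ zero    = Q
    part₀ (suc _) = ∅
    in-0 : ∀ i {v} → v ∈ part₀ i → i ≡ 0
    in-0 zero    _  = refl
    in-0 (suc _) v∈ = ⊥-elim (∉⊥ v∈)
    in-Q : ∀ i {v} → v ∈ part₀ i → v ∈ Q
    in-Q zero    v∈ = v∈
    in-Q (suc _) v∈ = ⊥-elim (∉⊥ v∈)
    covered₀ : ∀ v → v ∈ ⊤ ─ Q ⊎ ∃ λ i → v ∈ part₀ i
    covered₀ v with v ∈? Q
    ... | yes v∈Q = inj₂ (0 , v∈Q)
    ... | no  v∉Q = inj₁ (x∈p∧x∉q⇒x∈p─q ∈⊤ v∉Q)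
    connected₀ : ∀ i → ConnectedIn G (part₀ i)
    connected₀ zero    = connected
    connected₀ (suc _) _ _ a∈ _ = ⊥-elim (∉⊥ a∈)
    dominated₀ : ∀ {i j} → i ≢ j → Ancestor′ (λ _ → 0) i j →
                 ∀ {v} → v ∈ part₀ j → AdjacentTo G v (part₀ i)
    dominated₀ {i} {j} i≢j anc v∈ with in-0 j v∈
    ... | refl = ⊥-elim (i≢j (n≤0⇒n≡0 (ancestor′-≤ (λ _ → z≤n) anc)))
    attached₀ : ∀ {u} → u ∈ ⊤ ─ Q → ∀ i → AdjacentTo G u (part₀ i) ⇔ Ancestor′ (λ _ → 0) i 0
    attached₀ u∈U zero    = mk⇔ (λ _ → 0 , refl) (λ _ → dominates u∈U)
    attached₀ u∈U (suc i) = mk⇔ (λ (_ , w∈ , _) → ⊥-elim (∉⊥ w∈))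
                                (λ anc → ⊥-elim (<⇒≱ z<s (ancestor′-≤ (λ _ → z≤n) anc)))
    uniform₀ : ∀ {a b} → a ∈ ⊤ ─ Q → b ∈ ⊤ ─ Q → Adj G a b →
               ∀ i → AdjacentTo G a (part₀ i) → AdjacentTo G b (part₀ i)
    uniform₀ _ b∈U _ zero    _            = dominates b∈U
    uniform₀ _ _   _ (suc _) (_ , w∈ , _) = ⊥-elim (∉⊥ w∈)

  module Extend (s : PartialModel) {u : Fin (n G)} (u∈U : u ∈ PartialModel.U s) where

    open PartialModel s
    open Decreasing par-decreasing
    open Σ (grow u∈U) renaming (proj₁ to piece; proj₂ to no-frontier)
    open Piece piece renaming (connected to Q-connected; balanced to Q-balanced)

    y : ℕ
    y = proj₁ (attached u∈U)

    y<k : y < k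
    y<k = proj₁ (proj₂ (attached u∈U))

    part′ : ℕ → Subset (n G)
    part′ = part [ k ≔ Q ]

    par′ : ℕ → ℕ
    par′ = par [ k ≔ y ]

    U′ : Subset (n G)
    U′ = U ─ Q

    -- Q lies in the component of u in G[U], on which adjacency to each part is constant.
    Q-attached : ∀ {q} → q ∈ Q → ∀ i → AdjacentTo G q (part i) ⇔ Ancestor′ par i y
    Q-attached q∈Q i = ⇔-trans (mk⇔ (along (to-u q∈Q)) (along (walk-reverse (to-u q∈Q))))
                               (proj₂ (proj₂ (attached u∈U)) i)
      where
      along : ∀ {a b} → WalkIn G Q a b → AdjacentTo G a (part i) → AdjacentTo G b (part i)
      along = walk-transport _ (λ a∈ b∈ ab → uniform (Q⊆U a∈) (Q⊆U b∈) ab i)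

    <k⇒≢k : ∀ {i} → i < k → i ≢ k
    <k⇒≢k i<k refl = <-irrefl refl i<k

    part′-old : ∀ {i} → i ≢ k → part′ i ≡ part i
    part′-old = [≔]-other part

    in-part′ : ∀ {i v} → v ∈ part i → v ∈ part′ i
    in-part′ v∈ = subst (_ ∈_) (sym (part′-old (<k⇒≢k (part-bounded v∈)))) v∈

    adjacent-part′ : ∀ {i v} → i ≢ k → AdjacentTo G v (part i) → AdjacentTo G v (part′ i)
    adjacent-part′ i≢k = subst (AdjacentTo G _) (sym (part′-old i≢k))

    ancestor-old : ∀ {i j} → j < k → Ancestor′ par′ i j ⇔ Ancestor′ par i j
    ancestor-old = ancestor′-agree ≤-self ([≔]-other par ∘ <k⇒≢k)

    ancestor-new : ∀ {i} → i ≢ k → Ancestor′ par′ i k ⇔ Ancestor′ par i y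
    ancestor-new {i} i≢k = mk⇔ to-old from-old
      where
      par′-k : par′ k ≡ y
      par′-k = [≔]-same par k
      to-old : Ancestor′ par′ i k → Ancestor′ par i y
      to-old anc with to (ancestor′-unfold par′) anc
      ... | inj₁ i≡k  = ⊥-elim (i≢k i≡k)
      ... | inj₂ anc′ = to (ancestor-old y<k) (subst (Ancestor′ par′ i) par′-k anc′)
      from-old : Ancestor′ par i y → Ancestor′ par′ i k
      from-old anc = from (ancestor′-unfold par′)
        (inj₂ (subst (Ancestor′ par′ i) (sym par′-k) (from (ancestor-old y<k) anc)))

    ¬ancestor-new : ∀ {j} → j < k → ¬ Ancestor′ par′ k j
    ¬ancestor-new j<k anc = <⇒≱ j<k (ancestor′-≤ ≤-self (to (ancestor-old j<k) anc))

    par′-decreasing : Decreasing par′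
    par′-decreasing = record { fixes-0 = trans ([≔]-other par (<k⇒≢k 0<k)) fixes-0 ; below = below′ }
      where
      below′ : ∀ {z} → 0 < z → par′ z < z
      below′ {z} 0<z with z ≟ k
      ... | yes refl = y<k
      ... | no  _    = below 0<z

    part-bounded′ : ∀ {i v} → v ∈ part′ i → i < suc k
    part-bounded′ {i} v∈ with i ≟ k
    ... | yes refl = n<1+n k
    ... | no  _    = m<n⇒m<1+n (part-bounded v∈)

    covered′ : ∀ v → v ∈ U′ ⊎ ∃ λ i → v ∈ part′ i
    covered′ v with covered v | v ∈? Q
    ... | inj₂ (i , v∈) | _       = inj₂ (i , in-part′ v∈)
    ... | inj₁ _        | yes v∈Q = inj₂ (k , subst (v ∈_) (sym ([≔]-same part k)) v∈Q)
    ... | inj₁ v∈U      | no  v∉Q = inj₁ (x∈p∧x∉q⇒x∈p─q v∈U v∉Q)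

    U′-disjoint : ∀ {i v} → v ∈ U′ → v ∉ part′ i
    U′-disjoint {i} v∈U′ with i ≟ k
    ... | yes _ = x∈p─q⇒x∉q U Q v∈U′
    ... | no  _ = U-disjoint (p─q⊆p U Q v∈U′)

    part′-disjoint : ∀ {i j v} → v ∈ part′ i → v ∈ part′ j → i ≡ j
    part′-disjoint {i} {j} v∈i v∈j with i ≟ k | j ≟ k
    ... | yes refl | yes refl = refl
    ... | yes _    | no  _    = ⊥-elim (U-disjoint (Q⊆U v∈i) v∈j)
    ... | no  _    | yes _    = ⊥-elim (U-disjoint (Q⊆U v∈j) v∈i)
    ... | no  _    | no  _    = part-disjoint v∈i v∈j

    nonempty′ : ∀ {i} → i < suc k → Nonempty (part′ i)
    nonempty′ {i} i<1+k with i ≟ k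
    ... | yes _   = u , u∈Q
    ... | no  i≢k = nonempty (≤∧≢⇒< (≤-pred i<1+k) i≢k)

    connected′ : ∀ i → ConnectedIn G (part′ i)
    connected′ i with i ≟ k
    ... | yes _ = Q-connected
    ... | no  _ = connected i

    balanced′ : ∀ {i} → i < suc k → Balanced G (part′ i)
    balanced′ {i} i<1+k with i ≟ k
    ... | yes _   = Q-balanced
    ... | no  i≢k = balanced (≤∧≢⇒< (≤-pred i<1+k) i≢k)

    edge⇒ancestor′ : ∀ {i j} → i ≢ j → EdgeBetween G (part′ i) (part′ j) →
                     Ancestor′ par′ i j ⊎ Ancestor′ par′ j i
    edge⇒ancestor′ {i} {j} i≢j (a , b , a∈ , b∈ , ab) with i ≟ k | j ≟ k
    ... | yes refl | yes refl = ⊥-elim (i≢j refl)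
    ... | yes refl | no  j≢k  = inj₂ (from (ancestor-new j≢k) (to (Q-attached a∈ j) (b , b∈ , ab)))
    ... | no  i≢k  | yes refl = inj₁ (from (ancestor-new i≢k) (to (Q-attached b∈ i) (a , a∈ , adj-sym G ab)))
    ... | no  _    | no  _    = Sum.map (from (ancestor-old (part-bounded b∈)))
                                        (from (ancestor-old (part-bounded a∈)))
                                        (edge⇒ancestor i≢j (a , b , a∈ , b∈ , ab))

    dominated′ : ∀ {i j} → i ≢ j → Ancestor′ par′ i j →
                 ∀ {v} → v ∈ part′ j → AdjacentTo G v (part′ i)
    dominated′ {i} {j} i≢j anc v∈ with j ≟ k
    ... | yes refl = adjacent-part′ i≢j (from (Q-attached v∈ i) (to (ancestor-new i≢j) anc))
    ... | no  _    = adjacent-part′ i≢k (dominated i≢j anc′ v∈)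
      where
      anc′ : Ancestor′ par i j
      anc′ = to (ancestor-old (part-bounded v∈)) anc
      i≢k : i ≢ k
      i≢k = <k⇒≢k (≤-<-trans (ancestor′-≤ ≤-self anc′) (part-bounded v∈))

    attached′ : ∀ {w} → w ∈ U′ →
                ∃ λ y′ → y′ < suc k × ∀ i → AdjacentTo G w (part′ i) ⇔ Ancestor′ par′ i y′
    attached′ {w} w∈U′ with adjacentTo? w Q
    ... | yes (q , q∈Q , wq) = k , n<1+n k , below-Q
      where
      w∈U = p─q⊆p U Q w∈U′
      below-Q : ∀ i → AdjacentTo G w (part′ i) ⇔ Ancestor′ par′ i k
      below-Q i with i ≟ k
      ... | yes refl = mk⇔ (λ _ → ancestor′-refl par′) (λ _ → q , q∈Q , wq)
      ... | no  i≢k  = ⇔-trans (mk⇔ (uniform w∈U (Q⊆U q∈Q) wq i) (uniform (Q⊆U q∈Q) w∈U (adj-sym G wq) i))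
                                (⇔-trans (Q-attached q∈Q i) (⇔-sym (ancestor-new i≢k)))
    ... | no ¬wQ = yw , m<n⇒m<1+n yw<k , beside-Q
      where
      w-attached = attached (p─q⊆p U Q w∈U′)
      yw = proj₁ w-attached
      yw<k = proj₁ (proj₂ w-attached)
      beside-Q : ∀ i → AdjacentTo G w (part′ i) ⇔ Ancestor′ par′ i yw
      beside-Q i with i ≟ k
      ... | yes refl = mk⇔ (⊥-elim ∘ ¬wQ) (⊥-elim ∘ ¬ancestor-new yw<k)
      ... | no  _    = ⇔-trans (proj₂ (proj₂ w-attached) i) (⇔-sym (ancestor-old yw<k))

    uniform′ : ∀ {a b} → a ∈ U′ → b ∈ U′ → Adj G a b →
               ∀ i → AdjacentTo G a (part′ i) → AdjacentTo G b (part′ i)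
    uniform′ a∈ b∈ ab i with i ≟ k
    ... | yes _ = no-frontier⇒adjacent no-frontier a∈ b∈ ab
    ... | no  _ = uniform (p─q⊆p U Q a∈) (p─q⊆p U Q b∈) ab i

    extended : PartialModel
    extended = record
      { k = suc k ; part = part′ ; par = par′ ; U = U′ ; 0<k = z<s ; par-decreasing = par′-decreasing
      ; part-bounded = part-bounded′ ; covered = covered′ ; U-disjoint = λ {i} → U′-disjoint {i}
      ; part-disjoint = part′-disjoint ; nonempty = nonempty′ ; connected = connected′
      ; balanced = balanced′ ; edge⇒ancestor = edge⇒ancestor′ ; dominated = dominated′
      ; attached = attached′ ; uniform = uniform′ }

    shrinks : ∣ U′ ∣ < ∣ U ∣
    shrinks = p∩q≢∅⇒∣p─q∣<∣p∣ U Q (u , x∈p∩q⁺ (u∈U , u∈Q))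

  complete : 0 < n G → Connected G → Σ PartialModel λ s → Empty (PartialModel.U s)
  complete 0<n conn = saturate (∣_∣ ∘ PartialModel.U) advance (initial (fromℕ< 0<n) conn)
    where
    advance : ∀ s → Empty (PartialModel.U s)
                  ⊎ Σ PartialModel λ s′ → ∣ PartialModel.U s′ ∣ < ∣ PartialModel.U s ∣
    advance s with nonempty? (PartialModel.U s)
    ... | no  empty     = inj₁ empty
    ... | yes (_ , u∈U) = inj₂ (Extend.extended s u∈U , Extend.shrinks s u∈U)

  module Completed (s : PartialModel) (U-empty : Empty (PartialModel.U s)) where

    open PartialModel s
    open ℕTree 0<k par-decreasing public

    P : Fin k → Subset (n G)
    P x = part (toℕ x)

    nonemptyᶠ : ∀ x → Nonempty (P x)
    nonemptyᶠ x = nonempty (toℕ<n x)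

    disjointᶠ : ∀ x y → x ≢ y → Disjoint (P x) (P y)
    disjointᶠ x y x≢y v v∈x v∈y = x≢y (toℕ-injective (part-disjoint v∈x v∈y))

    coversᶠ : ∀ v → Σ (Fin k) λ x → v ∈ P x
    coversᶠ v with covered v
    ... | inj₁ v∈U       = ⊥-elim (U-empty (v , v∈U))
    ... | inj₂ (i , v∈i) = fromℕ< (part-bounded v∈i) , subst (λ j → v ∈ part j) (sym (toℕ-fromℕ< _)) v∈i

    dominatedᶠ : ∀ {x y} → x ≢ y → Ancestor tree x y → ∀ {v} → v ∈ P y → AdjacentTo G v (P x)
    dominatedᶠ x≢y anc = dominated (x≢y ∘ toℕ-injective) (to ancestor⇔ anc)

    ancestor⇒edge : ∀ {x y} → x ≢ y → Ancestor tree x y → EdgeBetween G (P x) (P y)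
    ancestor⇒edge {y = y} x≢y anc =
      let (b , b∈) = nonemptyᶠ y ; (a , a∈ , ba) = dominatedᶠ x≢y anc b∈
      in  a , b , a∈ , b∈ , adj-sym G ba

    adjacencyᶠ : ∀ x y → x ≢ y → (EdgeBetween G (P x) (P y) → Ancestor tree x y ⊎ Ancestor tree y x)
                                × (Ancestor tree x y ⊎ Ancestor tree y x → EdgeBetween G (P x) (P y))
    adjacencyᶠ x y x≢y = Sum.map (from ancestor⇔) (from ancestor⇔) ∘ edge⇒ancestor (x≢y ∘ toℕ-injective)
                       , Sum.[ ancestor⇒edge x≢y , edge-sym ∘ ancestor⇒edge (x≢y ∘ sym) ]
      where
      edge-sym : EdgeBetween G (P y) (P x) → EdgeBetween G (P x) (P y)
      edge-sym (b , a , b∈ , a∈ , ba) = a , b , a∈ , b∈ , adj-sym G ba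

    balancedᶠ : ∀ x → Σ (Subset (n G)) λ I → Independent G I × I ⊆ P x × ∣ P x ∣ ≡ 2 * ∣ I ∣ ∸ 1
    balancedᶠ x = let (I , I-ind , I⊆ , size) = balanced (toℕ<n x) in I , I-ind , I⊆ , cong (_∸ 1) size

    -- Every root path gives a dominating model, whether or not it ends at a leaf.
    root-pathsᶠ : ∀ v → Leaf tree v → ∀ j (xs : Fin (suc j) → Fin k) → RootPath tree v j xs →
                  DominatingModel G (suc j) (P ∘ xs)
    root-pathsᶠ _ _ _ xs (_ , _ , chain) =
        (λ a b a≢b → disjointᶠ (xs a) (xs b) (chain-injective chain a≢b))
      , nonemptyᶠ ∘ xs
      , connected ∘ toℕ ∘ xs
      , (λ a b a<b _ → dominatedᶠ (chain-injective chain (Finₚ.<⇒≢ a<b)) (chain-ancestor chain (<⇒≤ a<b)))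

    good : Good G tree P
    good = nonemptyᶠ , disjointᶠ , coversᶠ , connected ∘ toℕ , adjacencyᶠ , balancedᶠ , root-pathsᶠ

theorem13 : (G : Graph) → 0 < n G → Connected G →
    Σ RootedTree λ T → Σ (Fin (m T) → Subset (n G)) λ P → Good G T P
theorem13 G 0<n connected =
  let (s , U-empty) = complete 0<n connected in Completed.tree s U-empty , _ , Completed.good s U-empty
  where open Model G
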